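{- For positive integers $b$ define $(h_{1,b}(n))_{n\in\mathbb{N}}$ by $h_{1,b}(n)=1$ for integers $n\le 0$, $h_{1,b}(1)=b$, and $h_{1,b}(n)=h_{1,b}(n-h_{1,b}(n-1))+h_{1,b}(n-2)$ for $n>1$. Let $bin(n)$ denote the number of partitions of $n$ into powers of $2$, i.e. $\sum_{n\ge0}bin(n)x^n=\prod_{j\ge0}(1-x^{2^j})^{ -1}$. Then for all $n\in\mathbb{N}$, $$h_{1,2}(n)=h_{1,1}(n+1),$$ and more generally, for every integer $b\ge2$ and every $n\in\mathbb{N}$, $$h_{1,b}(2n+1)=(b-2)\,bin(n+1)+h_{1,1}(2n+2).$$
   Context: $bin(n)$ counts representations $n=\sum_{i=1}^k 2^{r_i}$ with $r_1\le\dots\le r_k$ in $\mathbb{N}$ ($bin(0)=1$). -}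

module Defs where

open import Data.Nat using (ℕ; zero; suc; _+_; _*_; _∸_; _^_; _≡ᵇ_; _≤ᵇ_)
open import Data.Bool using (if_then_else_)
open import Data.List using (map; upTo)
open import Data.Nat.ListAction using (sum)

-- h-table: hTab b n k = h_{1,b}(k) for all k ≤ n.
-- Indices k ≤ 0 of the paper are represented by k = 0 (truncated
-- subtraction n ∸ h(n-1) is 0 exactly when n - h(n-1) ≤ 0, and h(0) = 1).
hTab : ℕ → ℕ → (ℕ → ℕ)
hTab b zero = λ _ → 1
hTab b (suc zero) = λ k → if k ≡ᵇ 0 then 1 else b
hTab b (suc (suc n)) =
  let f = hTab b (suc n)
      v = f (suc (suc n) ∸ f (suc n)) + f n
  in λ k → if k ≡ᵇ suc (suc n) then v else f k

h : ℕ → ℕ → ℕ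
h b n = hTab b n n

-- parts j n = number of partitions of n into parts from {2^0, ..., 2^j}
-- (i.e. number of representations n = Σ 2^{r_i}, r_1 ≤ ... ≤ r_k ≤ j).
parts : ℕ → ℕ → ℕ
parts zero n = 1
parts (suc j) n =
  -- m = number of parts equal to 2^(j+1), ranging over m * 2^(j+1) ≤ n
  sum (map (λ m → if m * 2 ^ suc j ≤ᵇ n then parts j (n ∸ m * 2 ^ suc j) else 0)
           (upTo (suc n)))

-- bin n = number of partitions of n into powers of 2 (bin 0 = 1);
-- parts 2^r with 2^r ≤ n have r < n, so bounding exponents by n loses nothing.
bin : ℕ → ℕ
bin n = parts n n

{-# OPTIONS --safe #-}
-- Both h_{1,2} and n ↦ h_{1,1}(n+1) solve h(n+2) = h(n+2 − h(n+1)) + h(n) with initial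
-- values 1, 2 (the shift is harmless because h_{1,1}(0) = h_{1,1}(1)), and a solution of
-- this recursion is determined by its initial values.  A solution with h(0) = 1, h(1) ≥ 2
-- takes the value k+1 at 2k, while its odd values obey h(2k+3) = h(k+1) + h(2k+1); so the
-- difference between the odd values for b and for 2 obeys the recursion of the binary
-- partition function, bin(2m+1) = bin(2m) and bin(2m+2) = bin(2m+1) + bin(m+1).  These
-- recurrences come from removing the parts of the largest allowed size one at a time.
module Submission where

open import Defs
open import Data.Nat
open import Data.Nat.Properties
open import Data.Nat.Induction using (<-rec)
open import Algebra.Properties.CommutativeSemigroup +-commutativeSemigroup using (interchange; x∙yz≈y∙xz)
open import Data.Nat.ListAction using (sum)
open import Data.Bool using (true; false; if_then_else_)
open import Data.List using (map; upTo; applyUpTo)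
open import Data.List.Properties using (map-upTo)
open import Data.Product using (_×_; _,_)
open import Data.Sum using (inj₁; inj₂)
open import Function using (_∘_)
open import Relation.Binary.PropositionalEquality
open import Relation.Nullary using (yes; no; contradiction)
open import Data.Nat.Tactic.RingSolver using (solve-∀)

private
  variable
    b d k m n : ℕ
    f g : ℕ → ℕ

≡ᵇ-refl : ∀ n → (n ≡ᵇ n) ≡ true
≡ᵇ-refl zero = refl
≡ᵇ-refl (suc n) = ≡ᵇ-refl n

<⇒≡ᵇ-false : k < m → (k ≡ᵇ m) ≡ false
<⇒≡ᵇ-false {zero} z<s = refl
<⇒≡ᵇ-false {suc k} (s<s k<m) = <⇒≡ᵇ-false k<m

hTab-extend : ∀ b n → k ≤ n → hTab b (suc n) k ≡ hTab b n k
hTab-extend b zero z≤n = refl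
hTab-extend {k} b (suc n) k≤n rewrite <⇒≡ᵇ-false {k} (s≤s k≤n) = refl

hTab≡h : ∀ b n → k ≤ n → hTab b n k ≡ h b k
hTab≡h b n k≤n with m≤n⇒m<n∨m≡n k≤n
... | inj₂ refl = refl
hTab≡h b (suc n) _ | inj₁ (s≤s k≤n) = trans (hTab-extend b n k≤n) (hTab≡h b n k≤n)

hTab-positive : 1 ≤ b → ∀ n k → 1 ≤ hTab b n k
hTab-positive b≥1 zero k = s≤s z≤n
hTab-positive b≥1 (suc zero) zero = s≤s z≤n
hTab-positive b≥1 (suc zero) (suc k) = b≥1
hTab-positive b≥1 (suc (suc n)) k = if-preserves (k ≡ᵇ suc (suc n))
  (≤-trans (hTab-positive b≥1 (suc n) n) (m≤n+m _ _)) (hTab-positive b≥1 (suc n) k)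
  where
  if-preserves : ∀ c {x y} → 1 ≤ x → 1 ≤ y → 1 ≤ (if c then x else y)
  if-preserves true 1≤x _ = 1≤x
  if-preserves false _ 1≤y = 1≤y

h-positive : 1 ≤ b → ∀ n → 1 ≤ h b n
h-positive b≥1 n = hTab-positive b≥1 n n

∸-positive-< : 1 ≤ k → suc m ∸ k < suc m
∸-positive-< {suc k} {m} _ = s≤s (m∸n≤m m k)

-- Solutions of the Hofstadter-type recursion

IsHofstadter : (ℕ → ℕ) → Set
IsHofstadter f = ∀ n → f (2 + n) ≡ f (2 + n ∸ f (1 + n)) + f n

h-isHofstadter : 1 ≤ b → IsHofstadter (h b)
h-isHofstadter {b} b≥1 n rewrite ≡ᵇ-refl n =
  cong₂ _+_ (hTab≡h b (suc n) (∸-monoʳ-≤ (2 + n) (h-positive b≥1 (suc n))))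
            (hTab≡h b (suc n) (n≤1+n n))

IsHofstadter-unique : IsHofstadter f → f 0 ≡ 1 → f 1 ≡ b → 1 ≤ b → ∀ n → f n ≡ h b n
IsHofstadter-unique {f} {b} f-rec f0 f1 b≥1 = <-rec _ agree
  where
  open ≡-Reasoning
  agree : ∀ n → (∀ {m} → m < n → f m ≡ h b m) → f n ≡ h b n
  agree zero _ = f0
  agree (suc zero) _ = f1
  agree (suc (suc n)) ih = begin
    f (2 + n)                          ≡⟨ f-rec n ⟩
    f (2 + n ∸ f (1 + n)) + f n        ≡⟨ cong (λ x → f (2 + n ∸ x) + f n) (ih (n<1+n _)) ⟩
    f (2 + n ∸ h b (1 + n)) + f n      ≡⟨ cong₂ _+_ (ih (∸-positive-< (h-positive b≥1 (1 + n))))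
                                                    (ih (m<n⇒m<1+n (n<1+n n))) ⟩
    h b (2 + n ∸ h b (1 + n)) + h b n  ≡⟨ h-isHofstadter b≥1 n ⟨
    h b (2 + n)                        ∎

IsHofstadter-∘suc : IsHofstadter f → f 0 ≡ f 1 → IsHofstadter (f ∘ suc)
IsHofstadter-∘suc {f} f-rec f0≡f1 n =
  trans (f-rec (suc n)) (cong (_+ f (suc n)) (f-suc-∸ (2 + n) (f (2 + n))))
  where
  -- f cannot tell apart the two ways of truncating, as f 0 ≡ f 1.
  f-suc-∸ : ∀ m k → f (suc m ∸ k) ≡ f (suc (m ∸ k))
  f-suc-∸ m zero = refl
  f-suc-∸ zero (suc k) = trans (cong f (0∸n≡0 k)) f0≡f1
  f-suc-∸ (suc m) (suc k) = f-suc-∸ m k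

h2≡h1∘suc : ∀ n → h 2 n ≡ h 1 (suc n)
h2≡h1∘suc n =
  sym (IsHofstadter-unique {h 1 ∘ suc} (IsHofstadter-∘suc {h 1} (h-isHofstadter ≤-refl) refl)
                           refl refl (s≤s z≤n) n)

record ParityForm (f : ℕ → ℕ) : Set where
  field
    at-even : ∀ k → f (2 * k) ≡ suc k
    at-odd  : ∀ k → f (3 + 2 * k) ≡ f (1 + k) + f (1 + 2 * k)

IsHofstadter⇒ParityForm : IsHofstadter f → f 0 ≡ 1 → 2 ≤ f 1 → ParityForm f
IsHofstadter⇒ParityForm {f} f-rec f0 f1≥2 = record { at-even = at-even ; at-odd = at-odd }
  where
  positive : ∀ n → 1 ≤ f n
  positive zero = ≤-reflexive (sym f0)
  positive (suc zero) = ≤-trans (s≤s z≤n) f1≥2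
  positive (suc (suc n)) rewrite f-rec n = ≤-trans (positive n) (m≤n+m _ _)

  ≥2 : ∀ n → 2 ≤ f (suc n)
  ≥2 zero = f1≥2
  ≥2 (suc n) rewrite f-rec n = +-mono-≤ (positive _) (positive n)

  -- At 2k + 3 the recursion looks back to 2k + 3 − (k + 2) = k + 1.
  odd-step : ∀ k → f (2 + 2 * k) ≡ 2 + k → f (3 + 2 * k) ≡ f (1 + k) + f (1 + 2 * k)
  odd-step k f[2+2k] = trans (f-rec (1 + 2 * k)) (cong (λ i → f i + f (1 + 2 * k)) (begin
    3 + 2 * k ∸ f (2 + 2 * k)  ≡⟨ cong (3 + 2 * k ∸_) f[2+2k] ⟩
    1 + 2 * k ∸ k              ≡⟨ cong (λ x → suc (k + x) ∸ k) (+-identityʳ k) ⟩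
    1 + k + k ∸ k              ≡⟨ m+n∸n≡m (1 + k) k ⟩
    1 + k                      ∎))
    where open ≡-Reasoning

  -- Since f (1 + 2k) ≥ 2 + 2k, at 2k + 2 the recursion looks back to 0.
  even-step : ∀ k → f (2 * k) ≡ suc k → 2 + 2 * k ≤ f (1 + 2 * k) → f (2 + 2 * k) ≡ 2 + k
  even-step k f[2k] f[1+2k]≥ = begin
    f (2 + 2 * k)                             ≡⟨ f-rec (2 * k) ⟩
    f (2 + 2 * k ∸ f (1 + 2 * k)) + f (2 * k) ≡⟨ cong₂ _+_ (cong f (m≤n⇒m∸n≡0 f[1+2k]≥)) f[2k] ⟩
    f 0 + suc k                               ≡⟨ cong (_+ suc k) f0 ⟩
    2 + k                                     ∎
    where open ≡-Reasoning

  at-even : ∀ k → f (2 * k) ≡ suc k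
  at-2+2k : ∀ k → f (2 + 2 * k) ≡ 2 + k
  odd-bound : ∀ k → 2 + 2 * k ≤ f (1 + 2 * k)

  at-even zero = f0
  at-even (suc k) = trans (cong f (*-suc 2 k)) (at-2+2k k)

  at-2+2k k = even-step k (at-even k) (odd-bound k)

  odd-bound zero = f1≥2
  odd-bound (suc k) = subst (λ x → 2 + x ≤ f (1 + x)) (sym (*-suc 2 k))
    (≤-trans (+-mono-≤ (≥2 k) (odd-bound k)) (≤-reflexive (sym (odd-step k (at-2+2k k)))))

  at-odd : ∀ k → f (3 + 2 * k) ≡ f (1 + k) + f (1 + 2 * k)
  at-odd k = odd-step k (at-2+2k k)

-- Binary partitions

strideTerm : ℕ → (ℕ → ℕ) → ℕ → ℕ → ℕ
strideTerm K f n i = if i * K ≤ᵇ n then f (n ∸ i * K) else 0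

-- parts (suc j) is, by definition, strideSum (2 ^ suc j) (parts j).
strideSum : ℕ → (ℕ → ℕ) → ℕ → ℕ
strideSum K f n = sum (map (strideTerm K f n) (upTo (suc n)))

if-≤ᵇ-yes : ∀ {A : Set} {x y : A} → m ≤ n → (if m ≤ᵇ n then x else y) ≡ x
if-≤ᵇ-yes {m} {n} m≤n with m ≤ᵇ n | ≤⇒≤ᵇ m≤n
... | true | _ = refl

if-≤ᵇ-no : ∀ {A : Set} {x y : A} → n < m → (if m ≤ᵇ n then x else y) ≡ y
if-≤ᵇ-no {n} {m} n<m with m ≤ᵇ n | ≤ᵇ⇒≤ m n
... | false | _ = refl
... | true | m≤n = contradiction (m≤n _) (<⇒≱ n<m)

sum-applyUpTo-cong : ∀ {g g′ : ℕ → ℕ} n → (∀ i → g i ≡ g′ i) →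
                     sum (applyUpTo g n) ≡ sum (applyUpTo g′ n)
sum-applyUpTo-cong zero _ = refl
sum-applyUpTo-cong (suc n) g≡g′ = cong₂ _+_ (g≡g′ 0) (sum-applyUpTo-cong n (g≡g′ ∘ suc))

sum-applyUpTo-vanishing : ∀ (g : ℕ → ℕ) n → m ≤ n → (∀ i → m ≤ i → g i ≡ 0) →
                          sum (applyUpTo g n) ≡ sum (applyUpTo g m)
sum-applyUpTo-vanishing g zero z≤n _ = refl
sum-applyUpTo-vanishing g (suc n) z≤n g≡0 =
  cong₂ _+_ (g≡0 0 z≤n) (sum-applyUpTo-vanishing (g ∘ suc) n z≤n (λ i _ → g≡0 (suc i) z≤n))
sum-applyUpTo-vanishing g (suc n) (s≤s m≤n) g≡0 =
  cong (g 0 +_) (sum-applyUpTo-vanishing (g ∘ suc) n m≤n (λ i m≤i → g≡0 (suc i) (s≤s m≤i)))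

strideSum-unfold : ∀ K f n → strideSum K f n ≡ f n + sum (applyUpTo (strideTerm K f n ∘ suc) n)
strideSum-unfold K f n = cong sum (map-upTo (strideTerm K f n) (suc n))

strideSum-< : ∀ {K} f → n < K → strideSum K f n ≡ f n
strideSum-< {n} {K} f n<K = begin
  strideSum K f n                                        ≡⟨ strideSum-unfold K f n ⟩
  f n + sum (applyUpTo (strideTerm K f n ∘ suc) n)       ≡⟨ cong (f n +_) (sum-applyUpTo-vanishing _ n z≤n beyond) ⟩
  f n + 0                                                ≡⟨ +-identityʳ (f n) ⟩
  f n                                                    ∎
  where
  open ≡-Reasoning
  beyond : ∀ i → 0 ≤ i → strideTerm K f n (suc i) ≡ 0
  beyond i _ = if-≤ᵇ-no (≤-trans n<K (m≤m+n K (i * K)))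

strideSum-+ : ∀ {K} f n → 1 ≤ K → strideSum K f (K + n) ≡ f (K + n) + strideSum K f n
strideSum-+ {K} f n K≥1 = begin
  strideSum K f (K + n)
    ≡⟨ strideSum-unfold K f (K + n) ⟩
  f (K + n) + sum (applyUpTo (strideTerm K f (K + n) ∘ suc) (K + n))
    ≡⟨ cong (f (K + n) +_) (sum-applyUpTo-cong (K + n) shift) ⟩
  f (K + n) + sum (applyUpTo (strideTerm K f n) (K + n))
    ≡⟨ cong (f (K + n) +_) (sum-applyUpTo-vanishing _ (K + n) (+-monoˡ-≤ n K≥1) beyond) ⟩
  f (K + n) + sum (applyUpTo (strideTerm K f n) (suc n))
    ≡⟨ cong (λ s → f (K + n) + sum s) (map-upTo (strideTerm K f n) (suc n)) ⟨
  f (K + n) + strideSum K f n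
    ∎
  where
  open ≡-Reasoning
  shift : ∀ i → strideTerm K f (K + n) (suc i) ≡ strideTerm K f n i
  shift i with i * K ≤? n
  ... | yes iK≤n = begin
    strideTerm K f (K + n) (suc i)  ≡⟨ if-≤ᵇ-yes (+-monoʳ-≤ K iK≤n) ⟩
    f (K + n ∸ (K + i * K))         ≡⟨ cong f ([m+n]∸[m+o]≡n∸o K n (i * K)) ⟩
    f (n ∸ i * K)                   ≡⟨ if-≤ᵇ-yes iK≤n ⟨
    strideTerm K f n i              ∎
  ... | no iK≰n = trans (if-≤ᵇ-no (+-monoʳ-< K (≰⇒> iK≰n))) (sym (if-≤ᵇ-no (≰⇒> iK≰n)))
  beyond : ∀ i → suc n ≤ i → strideTerm K f n i ≡ 0
  beyond i n<i = if-≤ᵇ-no (≤-trans n<i (m≤m*n i K {{>-nonZero K≥1}}))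

strideSum-self : ∀ {K} f → 1 ≤ K → strideSum K f K ≡ f K + f 0
strideSum-self {K} f K≥1 = begin
  strideSum K f K              ≡⟨ cong (strideSum K f) (+-identityʳ K) ⟨
  strideSum K f (K + 0)        ≡⟨ strideSum-+ f 0 K≥1 ⟩
  f (K + 0) + strideSum K f 0  ≡⟨ cong₂ _+_ (cong f (+-identityʳ K)) (strideSum-< f K≥1) ⟩
  f K + f 0                    ∎
  where open ≡-Reasoning

strideInduction : ∀ {ℓ} (P : ℕ → Set ℓ) {L} → 1 ≤ L →
                  (∀ m → m < L → P m) → (∀ m → P m → P (L + m)) → ∀ m → P m
strideInduction P {L} L≥1 below above = <-rec P go
  where
  go : ∀ m → (∀ {k} → k < m → P k) → P m
  go m ih with m <? L
  ... | yes m<L = below m m<L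
  ... | no m≮L = subst P (m+[n∸m]≡n L≤m) (above (m ∸ L) (ih (∸-monoʳ-< L≥1 L≤m)))
    where L≤m = ≮⇒≥ m≮L

1≤2* : 1 ≤ n → 1 ≤ 2 * n
1≤2* {n} n≥1 = ≤-trans n≥1 (m≤m+n n (n + 0))

1+2*-< : m < n → 1 + 2 * m < 2 * n
1+2*-< {m} {n} m<n = subst (_≤ 2 * n) (*-suc 2 m) (*-monoʳ-≤ 2 m<n)

strideSum-odd : ∀ f {L} → 1 ≤ L → (∀ m → f (1 + 2 * m) ≡ f (2 * m)) →
                ∀ m → strideSum (2 * L) f (1 + 2 * m) ≡ strideSum (2 * L) f (2 * m)
strideSum-odd f {L} L≥1 f-odd = strideInduction _ L≥1 below above
  where
  open ≡-Reasoning
  K = 2 * L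
  S = strideSum K f

  K≥1 : 1 ≤ K
  K≥1 = 1≤2* L≥1

  below : ∀ m → m < L → S (1 + 2 * m) ≡ S (2 * m)
  below m m<L = begin
    S (1 + 2 * m)  ≡⟨ strideSum-< f (1+2*-< m<L) ⟩
    f (1 + 2 * m)  ≡⟨ f-odd m ⟩
    f (2 * m)      ≡⟨ strideSum-< f (*-monoʳ-< 2 m<L) ⟨
    S (2 * m)      ∎

  above : ∀ m → S (1 + 2 * m) ≡ S (2 * m) → S (1 + 2 * (L + m)) ≡ S (2 * (L + m))
  above m S-odd = begin
    S (1 + 2 * (L + m))            ≡⟨ cong (S ∘ suc) 2*[L+m] ⟩
    S (1 + (K + 2 * m))            ≡⟨ cong S (+-suc K (2 * m)) ⟨
    S (K + (1 + 2 * m))            ≡⟨ strideSum-+ f (1 + 2 * m) K≥1 ⟩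
    f (K + (1 + 2 * m)) + S (1 + 2 * m) ≡⟨ cong₂ _+_ f-odd-above S-odd ⟩
    f (K + 2 * m) + S (2 * m)      ≡⟨ strideSum-+ f (2 * m) K≥1 ⟨
    S (K + 2 * m)                  ≡⟨ cong S 2*[L+m] ⟨
    S (2 * (L + m))                ∎
    where
    2*[L+m] : 2 * (L + m) ≡ K + 2 * m
    2*[L+m] = *-distribˡ-+ 2 L m
    f-odd-above : f (K + (1 + 2 * m)) ≡ f (K + 2 * m)
    f-odd-above = begin
      f (K + (1 + 2 * m))  ≡⟨ cong f (+-suc K (2 * m)) ⟩
      f (1 + (K + 2 * m))  ≡⟨ cong (f ∘ suc) 2*[L+m] ⟨
      f (1 + 2 * (L + m))  ≡⟨ f-odd (L + m) ⟩
      f (2 * (L + m))      ≡⟨ cong f 2*[L+m] ⟩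
      f (K + 2 * m)        ∎

strideSum-even : ∀ f g {L} → 1 ≤ L → f 0 ≡ g 0 → (∀ m → f (2 + 2 * m) ≡ f (2 * m) + g (1 + m)) →
  ∀ m → strideSum (2 * L) f (2 + 2 * m) ≡ strideSum (2 * L) f (2 * m) + strideSum L g (1 + m)
strideSum-even f g {L} L≥1 f0≡g0 f-even = strideInduction _ L≥1 below above
  where
  open ≡-Reasoning
  K = 2 * L
  S = strideSum K f
  T = strideSum L g

  at-boundary : ∀ {L} m → suc m ≡ L →
    strideSum (2 * L) f (2 + 2 * m) ≡ strideSum (2 * L) f (2 * m) + strideSum L g (1 + m)
  at-boundary m refl = begin
    strideSum (2 * suc m) f (2 + 2 * m)   ≡⟨ cong (strideSum (2 * suc m) f) (*-suc 2 m) ⟨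
    strideSum (2 * suc m) f (2 * suc m)   ≡⟨ strideSum-self f (s≤s z≤n) ⟩
    f (2 * suc m) + f 0                   ≡⟨ cong (λ x → f x + f 0) (*-suc 2 m) ⟩
    f (2 + 2 * m) + f 0                   ≡⟨ cong (_+ f 0) (f-even m) ⟩
    f (2 * m) + g (1 + m) + f 0           ≡⟨ +-assoc (f (2 * m)) _ _ ⟩
    f (2 * m) + (g (1 + m) + f 0)         ≡⟨ cong (λ x → f (2 * m) + (g (1 + m) + x)) f0≡g0 ⟩
    f (2 * m) + (g (1 + m) + g 0)         ≡⟨ cong₂ _+_ (strideSum-< f (*-monoʳ-< 2 (n<1+n m)))
                                                       (strideSum-self g (s≤s z≤n)) ⟨
    strideSum (2 * suc m) f (2 * m) + strideSum (suc m) g (1 + m) ∎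

  below : ∀ m → m < L → S (2 + 2 * m) ≡ S (2 * m) + T (1 + m)
  below m m<L with m≤n⇒m<n∨m≡n m<L
  ... | inj₂ 1+m≡L = at-boundary m 1+m≡L
  ... | inj₁ 1+m<L = begin
    S (2 + 2 * m)            ≡⟨ strideSum-< f (subst (_< K) (*-suc 2 m) (*-monoʳ-< 2 1+m<L)) ⟩
    f (2 + 2 * m)            ≡⟨ f-even m ⟩
    f (2 * m) + g (1 + m)    ≡⟨ cong₂ _+_ (strideSum-< f (*-monoʳ-< 2 m<L)) (strideSum-< g 1+m<L) ⟨
    S (2 * m) + T (1 + m)    ∎

  above : ∀ m → S (2 + 2 * m) ≡ S (2 * m) + T (1 + m) →
          S (2 + 2 * (L + m)) ≡ S (2 * (L + m)) + T (1 + (L + m))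
  above m S-even = begin
    S (2 + 2 * (L + m))
      ≡⟨ cong S [2+2*[L+m]] ⟩
    S (K + (2 + 2 * m))
      ≡⟨ strideSum-+ f (2 + 2 * m) K≥1 ⟩
    f (K + (2 + 2 * m)) + S (2 + 2 * m)
      ≡⟨ cong₂ _+_ f-even-above S-even ⟩
    (f (K + 2 * m) + g (L + (1 + m))) + (S (2 * m) + T (1 + m))
      ≡⟨ interchange (f (K + 2 * m)) _ _ _ ⟩
    (f (K + 2 * m) + S (2 * m)) + (g (L + (1 + m)) + T (1 + m))
      ≡⟨ cong₂ _+_ (strideSum-+ f (2 * m) K≥1) (strideSum-+ g (1 + m) L≥1) ⟨
    S (K + 2 * m) + T (L + (1 + m))
      ≡⟨ cong₂ _+_ (cong S 2*[L+m]) (cong T (sym (+-suc L m))) ⟨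
    S (2 * (L + m)) + T (1 + (L + m))
      ∎
    where
    K≥1 : 1 ≤ K
    K≥1 = 1≤2* L≥1
    2*[L+m] : 2 * (L + m) ≡ K + 2 * m
    2*[L+m] = *-distribˡ-+ 2 L m
    [2+2*[L+m]] : 2 + 2 * (L + m) ≡ K + (2 + 2 * m)
    [2+2*[L+m]] = trans (cong (2 +_) 2*[L+m]) (x∙yz≈y∙xz 2 K (2 * m))
    f-even-above : f (K + (2 + 2 * m)) ≡ f (K + 2 * m) + g (L + (1 + m))
    f-even-above = begin
      f (K + (2 + 2 * m))                  ≡⟨ cong f [2+2*[L+m]] ⟨
      f (2 + 2 * (L + m))                  ≡⟨ f-even (L + m) ⟩
      f (2 * (L + m)) + g (1 + (L + m))    ≡⟨ cong₂ _+_ (cong f 2*[L+m]) (cong g (sym (+-suc L m))) ⟩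
      f (K + 2 * m) + g (L + (1 + m))      ∎

parts-zero : ∀ j → parts j 0 ≡ 1
parts-zero zero = refl
parts-zero (suc j) = trans (strideSum-< (parts j) (m^n>0 2 (suc j))) (parts-zero j)

parts-odd : ∀ j m → parts j (1 + 2 * m) ≡ parts j (2 * m)
parts-odd zero m = refl
parts-odd (suc j) = strideSum-odd (parts j) (m^n>0 2 j) (parts-odd j)

parts-even : ∀ j m → parts (suc j) (2 + 2 * m) ≡ parts (suc j) (2 * m) + parts j (1 + m)
parts-even zero m = trans (strideSum-+ (parts 0) (2 * m) (s≤s z≤n)) (+-comm 1 _)
parts-even (suc j) = strideSum-even (parts (suc j)) (parts j) (m^n>0 2 (suc j))
                       (trans (parts-zero (suc j)) (sym (parts-zero j))) (parts-even j)

n<2^n : ∀ n → n < 2 ^ n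
n<2^n zero = s≤s z≤n
n<2^n (suc n) = +-mono-≤ (m^n>0 2 n) (≤-trans (n<2^n n) (m≤m+n (2 ^ n) 0))

parts-stable : ∀ d n → parts (d + n) n ≡ bin n
parts-stable zero n = refl
parts-stable (suc d) n = trans (strideSum-< (parts (d + n)) n<2^[1+d+n]) (parts-stable d n)
  where
  n<2^[1+d+n] : n < 2 ^ suc (d + n)
  n<2^[1+d+n] = <-≤-trans (n<2^n n) (^-monoʳ-≤ 2 (m≤n+m n (suc d)))

bin-odd : ∀ m → bin (1 + 2 * m) ≡ bin (2 * m)
bin-odd m = trans (parts-odd (1 + 2 * m) m) (parts-stable 1 (2 * m))

bin-even : ∀ m → bin (2 + 2 * m) ≡ bin (1 + 2 * m) + bin (1 + m)
bin-even m = begin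
  bin (2 + 2 * m)                                ≡⟨ parts-even (1 + 2 * m) m ⟩
  parts (2 + 2 * m) (2 * m) + parts (1 + 2 * m) (1 + m)
    ≡⟨ cong₂ _+_ (parts-stable 2 (2 * m)) (cong (λ j → parts j (1 + m)) 1+2*m≡m+[1+m]) ⟩
  bin (2 * m) + parts (m + (1 + m)) (1 + m)      ≡⟨ cong₂ _+_ (sym (bin-odd m)) (parts-stable m (1 + m)) ⟩
  bin (1 + 2 * m) + bin (1 + m)                  ∎
  where
  open ≡-Reasoning
  1+2*m≡m+[1+m] : 1 + 2 * m ≡ m + (1 + m)
  1+2*m≡m+[1+m] = trans (cong (λ x → suc (m + x)) (+-identityʳ m)) (sym (+-suc m m))

data EvenOrOdd : ℕ → Set where
  even : ∀ k → EvenOrOdd (2 * k)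
  odd  : ∀ k → EvenOrOdd (1 + 2 * k)

evenOrOdd : ∀ n → EvenOrOdd n
evenOrOdd zero = even 0
evenOrOdd (suc n) with evenOrOdd n
... | even k = odd k
... | odd k = subst EvenOrOdd (*-suc 2 k) (even (suc k))

ParityForm-odd-gap : ParityForm f → ParityForm g → f 1 ≡ d + g 1 →
                     ∀ n → f (1 + 2 * n) ≡ d * bin (1 + n) + g (1 + 2 * n)
ParityForm-odd-gap {f} {g} {d} pf pg f1 = <-rec Gap gap
  where
  open ≡-Reasoning
  open ParityForm

  Gap : ℕ → Set
  Gap n = f (1 + 2 * n) ≡ d * bin (1 + n) + g (1 + 2 * n)

  regroup : ∀ e x y z → e * x + z + e * y ≡ e * (y + x) + z
  regroup = solve-∀

  -- For m = 2j this is the gap at j; for odd m, f and g agree at 1 + m.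
  look-back : ∀ m → (∀ {j} → j < suc m → Gap j) →
              f (1 + m) + d * bin (1 + m) ≡ d * bin (2 + m) + g (1 + m)
  look-back m ih with evenOrOdd m
  ... | even j = begin
    f (1 + 2 * j) + d * bin (1 + 2 * j)                  ≡⟨ cong (_+ d * bin (1 + 2 * j)) (ih (s≤s (m≤m+n j (j + 0)))) ⟩
    d * bin (1 + j) + g (1 + 2 * j) + d * bin (1 + 2 * j) ≡⟨ regroup d (bin (1 + j)) (bin (1 + 2 * j)) (g (1 + 2 * j)) ⟩
    d * (bin (1 + 2 * j) + bin (1 + j)) + g (1 + 2 * j)   ≡⟨ cong (λ x → d * x + g (1 + 2 * j)) (bin-even j) ⟨
    d * bin (2 + 2 * j) + g (1 + 2 * j)                   ∎
  ... | odd j = begin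
    f (2 + 2 * j) + d * bin (2 + 2 * j)  ≡⟨ cong₂ _+_ f≡g (cong (d *_) bin[3+2j]≡bin[2+2j]) ⟨
    g (2 + 2 * j) + d * bin (3 + 2 * j)  ≡⟨ +-comm (g (2 + 2 * j)) _ ⟩
    d * bin (3 + 2 * j) + g (2 + 2 * j)  ∎
    where
    f≡g : g (2 + 2 * j) ≡ f (2 + 2 * j)
    f≡g = subst (λ x → g x ≡ f x) (*-suc 2 j) (trans (at-even pg (suc j)) (sym (at-even pf (suc j))))
    bin[3+2j]≡bin[2+2j] : bin (3 + 2 * j) ≡ bin (2 + 2 * j)
    bin[3+2j]≡bin[2+2j] = subst (λ x → bin (suc x) ≡ bin x) (*-suc 2 j) (bin-odd (suc j))

  gap : ∀ n → (∀ {m} → m < n → Gap m) → Gap n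
  gap zero _ = trans f1 (cong (_+ g 1) (sym (*-identityʳ d)))
  gap (suc m) ih = begin
    f (1 + 2 * suc m)                              ≡⟨ cong (f ∘ suc) (*-suc 2 m) ⟩
    f (3 + 2 * m)                                  ≡⟨ at-odd pf m ⟩
    f (1 + m) + f (1 + 2 * m)                      ≡⟨ cong (f (1 + m) +_) (ih (n<1+n m)) ⟩
    f (1 + m) + (d * bin (1 + m) + g (1 + 2 * m))  ≡⟨ +-assoc (f (1 + m)) _ _ ⟨
    f (1 + m) + d * bin (1 + m) + g (1 + 2 * m)    ≡⟨ cong (_+ g (1 + 2 * m)) (look-back m ih) ⟩
    d * bin (2 + m) + g (1 + m) + g (1 + 2 * m)    ≡⟨ +-assoc (d * bin (2 + m)) _ _ ⟩
    d * bin (2 + m) + (g (1 + m) + g (1 + 2 * m))  ≡⟨ cong (d * bin (2 + m) +_) (at-odd pg m) ⟨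
    d * bin (2 + m) + g (3 + 2 * m)                ≡⟨ cong (λ x → d * bin (2 + m) + g (suc x)) (*-suc 2 m) ⟨
    d * bin (2 + m) + g (1 + 2 * suc m)            ∎

h-parityForm : 2 ≤ b → ParityForm (h b)
h-parityForm b≥2 = IsHofstadter⇒ParityForm (h-isHofstadter (≤-trans (s≤s z≤n) b≥2)) refl b≥2

theorem4p4 : ((n : ℕ) → h 2 n ≡ h 1 (suc n))
    × ((b : ℕ) → 2 ≤ b → (n : ℕ) → h b (suc (2 * n)) ≡ (b ∸ 2) * bin (suc n) + h 1 (2 + 2 * n))
theorem4p4 = h2≡h1∘suc , h-odd
  where
  h-odd : (b : ℕ) → 2 ≤ b → (n : ℕ) → h b (suc (2 * n)) ≡ (b ∸ 2) * bin (suc n) + h 1 (2 + 2 * n)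
  h-odd b b≥2 n = begin
    h b (1 + 2 * n)                            ≡⟨ ParityForm-odd-gap (h-parityForm b≥2) (h-parityForm ≤-refl)
                                                                     (sym (m∸n+n≡m b≥2)) n ⟩
    (b ∸ 2) * bin (1 + n) + h 2 (1 + 2 * n)    ≡⟨ cong ((b ∸ 2) * bin (1 + n) +_) (h2≡h1∘suc (1 + 2 * n)) ⟩
    (b ∸ 2) * bin (1 + n) + h 1 (2 + 2 * n)    ∎
    where open ≡-Reasoning
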